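{- Assume the univalence axiom. For any type $X$ and any $f:X\to X$, the type $\mathsf{Split}(X,f)$ is a retract of $\mathsf{QIdem}(X,f)$. That is, there exist maps $u:\mathsf{Split}(X,f)\to\mathsf{QIdem}(X,f)$ and $v:\mathsf{QIdem}(X,f)\to\mathsf{Split}(X,f)$ with $v(u(t))=t$ for all $t:\mathsf{Split}(X,f)$.
   Context: We work in intensional Martin-Löf type theory with a univalent universe $\mathsf{Type}$; $\mathsf{ap}_f$ is the action of $f$ on paths. Define $\mathsf{Retr}(X):=\sum_{A:\mathsf{Type}}\sum_{r:X\to A}\sum_{s:A\to X}\prod_{a:A}(r(s(a))=a)$. Define $\mathsf{Split}(X,f):=\sum_{(A,r,s,H):\mathsf{Retr}(X)}\prod_{x:X}(s(r(x))=f(x))$. Define $\mathsf{QIdem}(X,f):=\sum_{I:\prod_{x:X}(f(f(x))=f(x))}\prod_{x:X}(\mathsf{ap}_f(I(x))=I(f(x)))$. -}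

{-# OPTIONS --without-K #-}
module Defs where

open import Level using (Level)
open import Data.Product using (Σ; _,_; proj₁; proj₂; _×_)
open import Relation.Binary.PropositionalEquality using (_≡_; refl; cong)

isEquiv : {a b : Level} {A : Set a} {B : Set b} → (A → B) → Set _
isEquiv {A = A} {B} f =
  (Σ (B → A) λ g → (a : A) → g (f a) ≡ a) × (Σ (B → A) λ h → (b : B) → f (h b) ≡ b)

_≃_ : {a b : Level} → Set a → Set b → Set _
A ≃ B = Σ (A → B) isEquiv

idIsEquiv : {a : Level} {A : Set a} → isEquiv (λ (x : A) → x)
idIsEquiv = ((λ x → x) , λ _ → refl) , ((λ x → x) , λ _ → refl)

idtoeqv : {A B : Set} → A ≡ B → A ≃ B
idtoeqv refl = (λ x → x) , idIsEquiv

Univalence : Set₁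
Univalence = {A B : Set} → isEquiv (idtoeqv {A} {B})

ap : {A B : Set} (f : A → B) {x y : A} → x ≡ y → f x ≡ f y
ap f = cong f

Retr : Set → Set₁
Retr X = Σ Set λ A → Σ (X → A) λ r → Σ (A → X) λ s → (a : A) → r (s a) ≡ a

Split : (X : Set) → (X → X) → Set₁
Split X f = Σ (Retr X) λ R →
  (x : X) → proj₁ (proj₂ (proj₂ R)) (proj₁ (proj₂ R) x) ≡ f x

QIdem : (X : Set) → (X → X) → Set
QIdem X f = Σ ((x : X) → f (f x) ≡ f x) λ I → (x : X) → ap f (I x) ≡ I (f x)

_IsRetractOf_ : {a b : Level} → Set a → Set b → Set _
B IsRetractOf A = Σ (B → A) λ u → Σ (A → B) λ v → (t : B) → v (u t) ≡ t

{-# OPTIONS --without-K #-}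
-- The retraction fromQIdem splits a quasi-idempotent f through its
-- sequential limit  Lim = Σ (a : ℕ → X) Π n, f (a (n+1)) = a n,  with
-- r = toLim (the constant sequence at f x), s = head (a 0) and K = refl.
-- The retraction law toLim-head : toLim (head ℓ) = ℓ comes from a
-- characterisation of paths in Lim (Lim-path); the coherence J is what
-- makes the climbing paths of a sequence compatible (cong-f-connect).
--
-- The section toQIdem sends (A , r , s , H , K) to the canonical witness
-- I x = ap s (H (r x)) for s ∘ r, transported along K by homotopy induction.
-- For the retract equation we likewise reduce to f = s ∘ r and K = refl;
-- then a ↦ toLim (s a) is an equivalence A ≃ Lim satisfying the hypotheses
-- of Split-path (canonical-split), and corollary6p4 just assembles this.
module Submission where

open import Defs
open import Data.Nat using (ℕ; zero; suc)
open import Data.Product using (Σ; _,_; proj₁; proj₂)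
open import Function using (_∘_)
open import Relation.Binary.PropositionalEquality
  using (_≡_; refl; sym; trans; cong; cong₂; subst; cong-app; cong-≡id; module ≡-Reasoning)
open import Relation.Binary.PropositionalEquality.Properties
  using (trans-reflʳ; trans-assoc; trans-symˡ; cong-id; cong-∘; sym-cong; trans-cong)

infixr 30 _∙_
_∙_ : ∀ {ℓ} {A : Set ℓ} {x y z : A} → x ≡ y → y ≡ z → x ≡ z
_∙_ = trans

∙-cancelˡ : ∀ {ℓ} {A : Set ℓ} {x y z : A} (q : x ≡ y) (r : x ≡ z) → q ∙ (sym q ∙ r) ≡ r
∙-cancelˡ refl r = refl

cong-const : ∀ {a b} {A : Set a} {B : Set b} (c : B) {x y : A} (p : x ≡ y) → cong (λ _ → c) p ≡ refl
cong-const c refl = refl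

isContr : ∀ {ℓ} → Set ℓ → Set ℓ
isContr A = Σ A λ c → (x : A) → c ≡ x

module Univalent (ua : Univalence) where

  -- Equivalence induction: a family over equivalences out of A is inhabited
  -- everywhere once it holds at the identity, since every equivalence is
  -- idtoeqv of a path.
  ≃-ind : ∀ {ℓ} {A : Set} (Q : (B : Set) → A ≃ B → Set ℓ) → Q A (idtoeqv refl)
        → {B : Set} (e : A ≃ B) → Q B e
  ≃-ind {A = A} Q d {B} e =
    subst (Q B) (proj₂ (proj₂ ua) e) (on-paths B (proj₁ (proj₂ ua) e))
    where
    on-paths : (B : Set) (p : A ≡ B) → Q B (idtoeqv p)
    on-paths _ refl = d

  postcomp-contr : {A B : Set} (e : A ≃ B) (Y : Set) (y : Y → B)
                 → isContr (Σ (Y → A) λ g → proj₁ e ∘ g ≡ y)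
  postcomp-contr {A} e Y =
    ≃-ind (λ B e → (y : Y → B) → isContr (Σ (Y → A) λ g → proj₁ e ∘ g ≡ y)) at-id e
    where
    at-id : (y : Y → A) → isContr (Σ (Y → A) λ g → g ≡ y)
    at-id y = (y , refl) , λ { (g , refl) → refl }

  -- It is a retract of the fibre of post-composition with
  -- the projection Σ X P → X (an equivalence) over the identity.
  weak-funext : {X : Set} {P : X → Set} → ((x : X) → isContr (P x)) → isContr ((x : X) → P x)
  weak-funext {X} {P} c = retract (proj₁ fibre) , λ φ → cong retract (proj₂ fibre (section φ))
    where
    pr₁≃ : Σ X P ≃ X
    pr₁≃ = proj₁ , ((λ x → x , proj₁ (c x)) , λ { (x , y) → cong (x ,_) (proj₂ (c x) y) })
                 , ((λ x → x , proj₁ (c x)) , λ x → refl)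
    fibre = postcomp-contr pr₁≃ X (λ x → x)
    retract : (Σ (X → Σ X P) λ g → proj₁ ∘ g ≡ (λ x → x)) → (x : X) → P x
    retract (g , q) x = subst P (cong-app q x) (proj₂ (g x))
    section : ((x : X) → P x) → Σ (X → Σ X P) λ g → proj₁ ∘ g ≡ (λ x → x)
    section φ = (λ x → x , φ x) , refl

  homotopies-contr : {X : Set} {P : X → Set} (f : (x : X) → P x)
                   → isContr (Σ ((x : X) → P x) λ g → (x : X) → f x ≡ g x)
  homotopies-contr {X} {P} f = unzip (proj₁ pointwise) , λ z → cong unzip (proj₂ pointwise (zip z))
    where
    pointwise = weak-funext {X} {λ x → Σ (P x) λ y → f x ≡ y} (λ x → (f x , refl) , λ { (y , refl) → refl })
    unzip : ((x : X) → Σ (P x) λ y → f x ≡ y) → Σ ((x : X) → P x) λ g → (x : X) → f x ≡ g x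
    unzip φ = (λ x → proj₁ (φ x)) , (λ x → proj₂ (φ x))
    zip : (Σ ((x : X) → P x) λ g → (x : X) → f x ≡ g x) → (x : X) → Σ (P x) λ y → f x ≡ y
    zip (g , h) x = g x , h x

  module _ {X : Set} {P : X → Set} (f : (x : X) → P x) where
    private
      centre-path : (z : Σ ((x : X) → P x) λ g → (x : X) → f x ≡ g x) → (f , λ _ → refl) ≡ z
      centre-path z = sym (proj₂ (homotopies-contr f) (f , λ _ → refl)) ∙ proj₂ (homotopies-contr f) z

    ~-ind : ∀ {ℓ} (Q : (g : (x : X) → P x) → ((x : X) → f x ≡ g x) → Set ℓ) → Q f (λ _ → refl)
          → (g : (x : X) → P x) (h : (x : X) → f x ≡ g x) → Q g h
    ~-ind Q d g h = subst (λ z → Q (proj₁ z) (proj₂ z)) (centre-path (g , h)) d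

    ~-ind-β : ∀ {ℓ} (Q : (g : (x : X) → P x) → ((x : X) → f x ≡ g x) → Set ℓ) (d : Q f (λ _ → refl))
            → ~-ind Q d f (λ _ → refl) ≡ d
    ~-ind-β Q d = cong (λ π → subst (λ z → Q (proj₁ z) (proj₂ z)) π d)
                       (trans-symˡ (proj₂ (homotopies-contr f) (f , λ _ → refl)))

  funext : {X : Set} {P : X → Set} {f g : (x : X) → P x} → ((x : X) → f x ≡ g x) → f ≡ g
  funext {f = f} {g} h = ~-ind f (λ g _ → f ≡ g) refl g h

  module _ {X : Set} {f : X → X} {A : Set} (r : X → A) (s : A → X)
           (H : (a : A) → r (s a) ≡ a) (K : (x : X) → s (r x) ≡ f x) where
    SplitPathMotive : (B : Set) → A ≃ B → Set₁
    SplitPathMotive B e =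
      (r′ : X → B) (s′ : B → X) (H′ : (b : B) → r′ (s′ b) ≡ b) (K′ : (x : X) → s′ (r′ x) ≡ f x)
      (ρ : (x : X) → proj₁ e (r x) ≡ r′ x) (σ : (a : A) → s a ≡ s′ (proj₁ e a))
      → ((x : X) → K x ≡ σ (r x) ∙ (cong s′ (ρ x) ∙ K′ x))
      → ((a : A) → cong (proj₁ e) (H a) ≡ ρ (s a) ∙ (cong r′ (σ a) ∙ H′ (proj₁ e a)))
      → _≡_ {A = Split X f} ((A , r , s , H) , K) ((B , r′ , s′ , H′) , K′)

    Split-path : {B : Set} (e : A ≃ B) → SplitPathMotive B e
    Split-path e = ≃-ind SplitPathMotive (λ r′ s′ H′ K′ ρ σ → ~-ind r vary-r at-r r′ ρ s′ H′ K′ σ) e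
      where
      vary-s : (s′ : A → X) → ((a : A) → s a ≡ s′ a) → Set₁
      vary-s s′ σ = (H′ : (b : A) → r (s′ b) ≡ b) (K′ : (x : X) → s′ (r x) ≡ f x)
        → ((x : X) → K x ≡ σ (r x) ∙ K′ x)
        → ((a : A) → cong (λ x → x) (H a) ≡ cong r (σ a) ∙ H′ a)
        → _≡_ {A = Split X f} ((A , r , s , H) , K) ((A , r , s′ , H′) , K′)
      at-s : vary-s s (λ _ → refl)
      at-s H′ K′ K≡K′ H≡H′ =
        cong₂ (λ H K → _,_ {B = λ R → (x : X) → proj₁ (proj₂ (proj₂ R)) (proj₁ (proj₂ R) x) ≡ f x}
                           (A , r , s , H) K)
              (funext (λ a → sym (cong-id (H a)) ∙ H≡H′ a)) (funext K≡K′)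
      vary-r : (r′ : X → A) → ((x : X) → r x ≡ r′ x) → Set₁
      vary-r r′ ρ = (s′ : A → X) (H′ : (b : A) → r′ (s′ b) ≡ b) (K′ : (x : X) → s′ (r′ x) ≡ f x)
        (σ : (a : A) → s a ≡ s′ a)
        → ((x : X) → K x ≡ σ (r x) ∙ (cong s′ (ρ x) ∙ K′ x))
        → ((a : A) → cong (λ x → x) (H a) ≡ ρ (s a) ∙ (cong r′ (σ a) ∙ H′ a))
        → _≡_ {A = Split X f} ((A , r , s , H) , K) ((A , r′ , s′ , H′) , K′)
      at-r : vary-r r (λ _ → refl)
      at-r s′ H′ K′ σ = ~-ind s vary-s at-s s′ σ H′ K′

  module Limit (X : Set) (f : X → X) where
    Lim : Set
    Lim = Σ (ℕ → X) λ a → (n : ℕ) → f (a (suc n)) ≡ a n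

    head : Lim → X
    head (a , _) = a 0

    module _ (a : ℕ → X) (ξ : (n : ℕ) → f (a (suc n)) ≡ a n) where
      Compatible : (b : ℕ → X) → ((n : ℕ) → a n ≡ b n) → ((n : ℕ) → f (b (suc n)) ≡ b n) → Set
      Compatible b p ζ = (n : ℕ) → ξ n ∙ p n ≡ cong f (p (suc n)) ∙ ζ n

      private
        PathMotive : (b : ℕ → X) → ((n : ℕ) → a n ≡ b n) → Set
        PathMotive b p = (ζ : (n : ℕ) → f (b (suc n)) ≡ b n) → Compatible b p ζ
                       → _≡_ {A = Lim} (a , ξ) (b , ζ)

        path-at-refl : PathMotive a (λ _ → refl)
        path-at-refl ζ c = cong (a ,_) (funext (λ n → sym (trans-reflʳ (ξ n)) ∙ c n))

      Lim-path : (b : ℕ → X) (p : (n : ℕ) → a n ≡ b n) → PathMotive b p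
      Lim-path = ~-ind a PathMotive path-at-refl

      private
        HeadMotive : (b : ℕ → X) → ((n : ℕ) → a n ≡ b n) → Set
        HeadMotive b p = (ζ : (n : ℕ) → f (b (suc n)) ≡ b n) (c : Compatible b p ζ)
                       → cong head (Lim-path b p ζ c) ≡ p 0

        head-at-refl : HeadMotive a (λ _ → refl)
        head-at-refl ζ c = begin
          cong head (Lim-path a (λ _ → refl) ζ c)
            ≡⟨ cong (λ w → cong head (w ζ c)) (~-ind-β a PathMotive path-at-refl) ⟩
          cong head (cong (a ,_) φ)            ≡⟨ sym (cong-∘ φ) ⟩
          cong (λ _ → a 0) φ                   ≡⟨ cong-const (a 0) φ ⟩
          refl                                 ∎
          where
          open ≡-Reasoning
          φ = funext (λ n → sym (trans-reflʳ (ξ n)) ∙ c n)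

      Lim-path-head : (b : ℕ → X) (p : (n : ℕ) → a n ≡ b n) → HeadMotive b p
      Lim-path-head = ~-ind a HeadMotive head-at-refl

    constSeq : (x : X) → f x ≡ x → Lim
    constSeq x θ = (λ _ → x) , (λ _ → θ)

    module QuasiIdempotent (I : (x : X) → f (f x) ≡ f x) (J : (x : X) → cong f (I x) ≡ I (f x)) where
      toLim : X → Lim
      toLim x = constSeq (f x) (I x)

      -- Conjugating I x by γ : f x = w gives a path f w = w whose image
      -- under f is I w; this is the only place where J is used.
      cong-f-conjugate : {x w : X} (γ : f x ≡ w) → cong f ((sym (cong f γ) ∙ I x) ∙ γ) ≡ I w
      cong-f-conjugate {x} refl = cong (cong f) (trans-reflʳ (I x)) ∙ J x

      module Climb (a : ℕ → X) (ξ : (n : ℕ) → f (a (suc n)) ≡ a n) where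
        step : (k : ℕ) → f (a k) ≡ f (a (suc k))
        step k = sym (cong f (ξ k)) ∙ I (a (suc k))

        steps : (k : ℕ) → f (a 0) ≡ f (a k)
        steps zero = refl
        steps (suc k) = steps k ∙ step k

        connect : (n : ℕ) → f (a 0) ≡ a n
        connect n = steps (suc n) ∙ ξ n

        cong-f-connect : (k : ℕ) → I (a 0) ∙ steps k ≡ cong f (connect k)
        cong-f-connect zero = trans-reflʳ (I (a 0)) ∙ sym (cong-f-conjugate (ξ 0))
        cong-f-connect (suc k) = begin
          I (a 0) ∙ (steps k ∙ step k)                       ≡⟨ sym (trans-assoc (I (a 0))) ⟩
          (I (a 0) ∙ steps k) ∙ step k                       ≡⟨ cong (_∙ step k) (cong-f-connect k) ⟩
          cong f (steps (suc k) ∙ ξ k) ∙ step k              ≡⟨ cong (_∙ step k) (sym (trans-cong (steps (suc k)))) ⟩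
          (cong f (steps (suc k)) ∙ cong f (ξ k)) ∙ step k   ≡⟨ trans-assoc (cong f (steps (suc k))) ⟩
          cong f (steps (suc k)) ∙ (cong f (ξ k) ∙ step k)   ≡⟨ cong (cong f (steps (suc k)) ∙_) (∙-cancelˡ (cong f (ξ k)) _) ⟩
          cong f (steps (suc k)) ∙ I (a (suc k))             ≡⟨ cong (cong f (steps (suc k)) ∙_) (sym (cong-f-conjugate (ξ (suc k)))) ⟩
          cong f (steps (suc k)) ∙ cong f (step (suc k) ∙ ξ (suc k))
                                                             ≡⟨ trans-cong (steps (suc k)) ⟩
          cong f (steps (suc k) ∙ (step (suc k) ∙ ξ (suc k))) ≡⟨ cong (cong f) (sym (trans-assoc (steps (suc k)))) ⟩
          cong f (connect (suc k))                           ∎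
          where open ≡-Reasoning

        connect-compatible : Compatible (λ _ → f (a 0)) (λ _ → I (a 0)) a connect ξ
        connect-compatible n = sym (trans-assoc (I (a 0))) ∙ cong (_∙ ξ n) (cong-f-connect (suc n))

      open Climb using (connect; connect-compatible)

      toLim-head : (ℓ : Lim) → toLim (head ℓ) ≡ ℓ
      toLim-head (a , ξ) = Lim-path _ _ a (connect a ξ) ξ (connect-compatible a ξ)

      split : Split X f
      split = (Lim , toLim , head , toLim-head) , λ x → refl

      head-toLim-head-const : (x : X) (θ : f x ≡ x) → I x ≡ cong f θ
                            → cong head (toLim-head (constSeq x θ)) ≡ θ
      head-toLim-head-const x θ Ix≡fθ = begin
        cong head (toLim-head (constSeq x θ))
          ≡⟨ Lim-path-head _ _ (λ _ → x) (connect _ _) (λ _ → θ) (connect-compatible _ _) ⟩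
        (sym (cong f θ) ∙ I x) ∙ θ     ≡⟨ cong (λ i → (sym (cong f θ) ∙ i) ∙ θ) Ix≡fθ ⟩
        (sym (cong f θ) ∙ cong f θ) ∙ θ ≡⟨ cong (_∙ θ) (trans-symˡ (cong f θ)) ⟩
        θ                               ∎
        where open ≡-Reasoning

      toLim-head-const : (x : X) (θ : f x ≡ x) → I x ≡ cong f θ → toLim-head (toLim x) ≡ cong toLim θ
      toLim-head-const x θ Ix≡fθ = begin
        toLim-head (toLim x)                             ≡⟨ sym (cong-≡id toLim-head) ⟩
        cong (toLim ∘ head) (toLim-head (constSeq x θ))  ≡⟨ cong-∘ (toLim-head (constSeq x θ)) ⟩
        cong toLim (cong head (toLim-head (constSeq x θ))) ≡⟨ cong (cong toLim) (head-toLim-head-const x θ Ix≡fθ) ⟩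
        cong toLim θ                                     ∎
        where open ≡-Reasoning

  module Canonical {X A : Set} (r : X → A) (s : A → X) (H : (a : A) → r (s a) ≡ a) where
    cong-sr-sH : (a : A) → cong (s ∘ r) (cong s (H a)) ≡ cong s (H (r (s a)))
    cong-sr-sH a = begin
      cong (s ∘ r) (cong s (H a))   ≡⟨ sym (cong-∘ {f = s ∘ r} {g = s} (H a)) ⟩
      cong (s ∘ (r ∘ s)) (H a)      ≡⟨ cong-∘ {f = s} {g = r ∘ s} (H a) ⟩
      cong s (cong (r ∘ s) (H a))   ≡⟨ cong (cong s) (cong-≡id H) ⟩
      cong s (H (r (s a)))          ∎
      where open ≡-Reasoning

    qidem : QIdem X (s ∘ r)
    qidem = (λ x → cong s (H (r x))) , (λ x → cong-sr-sH (r x))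

    open Limit X (s ∘ r)
    open QuasiIdempotent (proj₁ qidem) (proj₂ qidem)

    A≃Lim : A ≃ Lim
    A≃Lim = toLim ∘ s
          , (r ∘ head , λ a → H (r (s a)) ∙ H a)
          , (r ∘ head , λ ℓ → toLim-head (toLim (head ℓ)) ∙ toLim-head ℓ)

    canonical-split : _≡_ {A = Split X (s ∘ r)} ((A , r , s , H) , λ _ → refl) split
    canonical-split =
      Split-path r s H (λ _ → refl) A≃Lim toLim head toLim-head (λ _ → refl)
                 (λ x → toLim-head (toLim x)) (λ a → sym (cong s (H a))) K-coherent H-coherent
      where
      open ≡-Reasoning
      K-coherent : (x : X) → refl ≡ sym (cong s (H (r x))) ∙ (cong head (toLim-head (toLim x)) ∙ refl)
      K-coherent x = sym (begin
        sym sH ∙ (cong head (toLim-head (toLim x)) ∙ refl)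
          ≡⟨ cong (λ c → sym sH ∙ (c ∙ refl)) (head-toLim-head-const (s (r x)) sH (sym (cong-sr-sH (r x)))) ⟩
        sym sH ∙ (sH ∙ refl)     ≡⟨ cong (sym sH ∙_) (trans-reflʳ sH) ⟩
        sym sH ∙ sH              ≡⟨ trans-symˡ sH ⟩
        refl                     ∎)
        where sH = cong s (H (r x))
      H-coherent : (a : A) → cong (toLim ∘ s) (H a)
                 ≡ toLim-head (toLim (s a)) ∙ (cong toLim (sym (cong s (H a))) ∙ toLim-head (toLim (s a)))
      H-coherent a = cong-∘ (H a) ∙ sym (begin
        toLim-head (toLim (s a)) ∙ (cong toLim (sym (cong s (H a))) ∙ toLim-head (toLim (s a)))
          ≡⟨ cong (λ z → z ∙ (cong toLim (sym (cong s (H a))) ∙ z)) toLim-sH ⟩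
        Y ∙ (cong toLim (sym (cong s (H a))) ∙ Y)  ≡⟨ cong (λ w → Y ∙ (w ∙ Y)) (sym (sym-cong (cong s (H a)))) ⟩
        Y ∙ (sym Y ∙ Y)                            ≡⟨ cong (Y ∙_) (trans-symˡ Y) ⟩
        Y ∙ refl                                   ≡⟨ trans-reflʳ Y ⟩
        Y                                          ∎)
        where
        Y = cong toLim (cong s (H a))
        toLim-sH : toLim-head (toLim (s a)) ≡ Y
        toLim-sH = toLim-head-const (s a) (cong s (H a)) (sym (cong-sr-sH a))

  toQIdem : (X : Set) (f : X → X) → Split X f → QIdem X f
  toQIdem X f ((A , r , s , H) , K) = ~-ind (s ∘ r) (λ g _ → QIdem X g) (Canonical.qidem r s H) f K

  fromQIdem : (X : Set) (f : X → X) → QIdem X f → Split X f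
  fromQIdem X f (I , J) = Limit.QuasiIdempotent.split X f I J

  fromQIdem-toQIdem : (X : Set) (f : X → X) (t : Split X f) → fromQIdem X f (toQIdem X f t) ≡ t
  fromQIdem-toQIdem X f ((A , r , s , H) , K) = ~-ind (s ∘ r) Retracts at-sr f K
    where
    Retracts : (g : X → X) → ((x : X) → s (r x) ≡ g x) → Set₁
    Retracts g K = fromQIdem X g (toQIdem X g ((A , r , s , H) , K)) ≡ ((A , r , s , H) , K)
    at-sr : Retracts (s ∘ r) (λ _ → refl)
    at-sr = cong (fromQIdem X (s ∘ r)) (~-ind-β (s ∘ r) (λ g _ → QIdem X g) (Canonical.qidem r s H))
          ∙ sym (Canonical.canonical-split r s H)

corollary6p4 : Univalence → (X : Set) (f : X → X) → Split X f IsRetractOf QIdem X f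
corollary6p4 ua X f = toQIdem X f , fromQIdem X f , fromQIdem-toQIdem X f
  where open Univalent ua
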